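{- Let $G=(A,B,E)$ be a bipartite graph, let $S^*$ be a semi-matching of $G$ that does not admit degree-minimizing paths of any length, and let $d^*=\operatorname{deg}_{\max}S^*$. Then $S^*$ can be partitioned into $d^*$ matchings $M_1,\dots,M_{d^*}$ such that for every $i$, $M_i$ is a maximum matching in the subgraph $G|_{A_i\times B_i}$ of $G$ induced by $A_i\cup B_i$, where $A_1=A$, $B_1=B$, and for $i>1$: $A_i=A\setminus\bigcup_{1\le j<i}A(M_j)$ and $B_i=B(M_{i-1})$.
   Context: $\deg_S(v)$ is the number of edges of $S$ at $v$ and $\operatorname{deg}_{\max}S=\max_{v\in A\cup B}\deg_S(v)$. A semi-matching is a set $S\subseteq E$ with $\deg_S(a)=1$ for all $a\in A$. A degree-minimizing path with respect to $S$ is a path $b_1,a_1,b_2,\dots,a_{k-1},b_k$ ($k\ge2$) with $(a_i,b_i)\in S$, $(a_i,b_{i+1})\in E\setminus S$, and $\deg_S(b_1)\ge\deg_S(b_k)+2$. For $M\subseteq E$, $A(M)$, $B(M)$ are the sets of $A$- and $B$-endpoints of edges of $M$. A maximum matching is a matching of largest cardinality. -}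

module Defs where

open import Data.Nat using (ℕ; zero; suc; _+_; _≤_; _⊔_; _<ᵇ_)
open import Data.Fin using (Fin; zero; suc; inject₁; fromℕ; toℕ)
open import Data.Bool using (Bool; true; false; if_then_else_; not; _∧_; T)
open import Data.List using (List; map; allFin; foldr)
open import Data.Nat.ListAction using (sum)
open import Data.Bool.ListAction using (and)
open import Data.Product using (Σ; _×_; ∃)
open import Function using (_∘_)
open import Function.Definitions using (Injective)
open import Relation.Binary.PropositionalEquality using (_≡_)
open import Relation.Nullary using (¬_)

-- A bipartite graph G = (A, B, E) with A = Fin m, B = Fin n.
-- Edge sets (E, semi-matchings, matchings) are decidable subsets of A × B.
EdgeSet : ℕ → ℕ → Set
EdgeSet m n = Fin m → Fin n → Bool

count : (k : ℕ) → (Fin k → Bool) → ℕ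
count k p = sum (map (λ i → if p i then 1 else 0) (allFin k))

maxFin : (k : ℕ) → (Fin k → ℕ) → ℕ
maxFin k f = foldr _⊔_ 0 (map f (allFin k))

_⊆_ : ∀ {m n} → EdgeSet m n → EdgeSet m n → Set
S ⊆ T = ∀ a b → S a b ≡ true → T a b ≡ true

degA : ∀ {m n} → EdgeSet m n → Fin m → ℕ
degA {n = n} S a = count n (S a)

degB : ∀ {m n} → EdgeSet m n → Fin n → ℕ
degB {m = m} S b = count m (λ a → S a b)

degMax : ∀ {m n} → EdgeSet m n → ℕ
degMax {m} {n} S = maxFin m (degA S) ⊔ maxFin n (degB S)

IsSemiMatching : ∀ {m n} → EdgeSet m n → EdgeSet m n → Set
IsSemiMatching E S = S ⊆ E × (∀ a → degA S a ≡ 1)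

-- A degree-minimizing path b_1, a_1, b_2, …, a_{k-1}, b_k with k = l + 1 ≥ 2
-- (vertices indexed from 0 here).  A path has pairwise distinct vertices.
record DegMinPath {m n} (E S : EdgeSet m n) : Set where
  field
    l      : ℕ
    l≥1    : 1 ≤ l
    bs     : Fin (suc l) → Fin n
    as     : Fin l → Fin m
    bs-inj : Injective _≡_ _≡_ bs
    as-inj : Injective _≡_ _≡_ as
    inS    : ∀ i → S (as i) (bs (inject₁ i)) ≡ true
    inE    : ∀ i → E (as i) (bs (suc i)) ≡ true
    notS   : ∀ i → S (as i) (bs (suc i)) ≡ false
    degGap : degB S (bs (fromℕ l)) + 2 ≤ degB S (bs zero)

IsMatching : ∀ {m n} → EdgeSet m n → Set
IsMatching M = (∀ a → degA M a ≤ 1) × (∀ b → degB M b ≤ 1)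

size : ∀ {m n} → EdgeSet m n → ℕ
size {m} M = sum (map (degA M) (allFin m))

induced : ∀ {m n} → EdgeSet m n → (Fin m → Bool) → (Fin n → Bool) → EdgeSet m n
induced E P Q a b = E a b ∧ P a ∧ Q b

IsMaximumMatching : ∀ {m n} → EdgeSet m n → EdgeSet m n → Set
IsMaximumMatching H M =
  M ⊆ H × IsMatching M × (∀ M' → M' ⊆ H → IsMatching M' → size M' ≤ size M)

IsPartition : ∀ {m n d} → EdgeSet m n → (Fin d → EdgeSet m n) → Set
IsPartition S M =
  (∀ i → M i ⊆ S) ×
  (∀ a b → S a b ≡ true → ∃ λ i → M i a b ≡ true) ×
  (∀ a b i j → M i a b ≡ true → M j a b ≡ true → i ≡ j)

inA : ∀ {m n} → EdgeSet m n → Fin m → Bool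
inA M a = not (degA M a <ᵇ 1)

inB : ∀ {m n} → EdgeSet m n → Fin n → Bool
inB M b = not (degB M b <ᵇ 1)

-- A_i = A \ ⋃_{j < i} A(M_j)   (0-based: A_0 = A)
Aᵢ : ∀ {m n d} → (Fin d → EdgeSet m n) → Fin d → Fin m → Bool
Aᵢ {d = d} M i a =
  and (map (λ j → if toℕ j <ᵇ toℕ i then not (inA (M j) a) else true) (allFin d))

-- B_0 = B, B_{i+1} = B(M_i)
Bᵢ : ∀ {m n d} → (Fin d → EdgeSet m n) → Fin d → Fin n → Bool
Bᵢ M zero    b = true
Bᵢ M (suc i) b = inB (M (inject₁ i)) b

-- Order the S-neighbours of each b ∈ B; the i-th layer M_i (0-based) consists of the edges (a, b) of S
-- in which a is the i-th neighbour of b. The layers partition S into matchings, and an edge of M_i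
-- automatically has its endpoints in A_i and B_i. To see that M_i is maximum there, let T be the set
-- of vertices reachable by S-edge/non-S-edge alternating walks from the b with deg_S b ≥ i + 2.
-- Without degree-minimizing paths every vertex of T has degree ≥ i + 1, so M_i covers T; and an
-- a ∈ A_i with an edge to B \ T has its S-partner outside T, hence at level exactly i. Counting
-- edges into T per vertex of T and edges out of T per vertex of A, any matching of the induced
-- subgraph therefore has at most as many edges of each kind as M_i.

module Submission where

open import Defs
open import Data.Nat using (ℕ; zero; suc; _+_; _≤_; _<_; _⊔_; z≤n; s≤s; s≤s⁻¹)
import Data.Nat as ℕ
open import Data.Nat.Properties
  using (≤-refl; ≤-reflexive; ≤-trans; <-≤-trans; <⇒≤; ≰⇒>; <-cmp; <-irrefl; m+1+n≰m; +-suc; +-comm;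
         +-mono-≤; +-monoʳ-≤; +-cancelˡ-≡; m≤m⊔n; m≤n⊔m; <ᵇ⇒<; <⇒<ᵇ; +-0-commutativeMonoid)
open import Data.Fin using (Fin; zero; suc; inject₁; fromℕ; toℕ; fromℕ<; punchIn; punchOut)
open import Data.Fin.Properties
  using (_≟_; any?; punchInᵢ≢i; punchIn-punchOut; toℕ-fromℕ<; toℕ-injective; toℕ-inject₁;
         injective⇒≤; inject₁-injective)
open import Data.Bool using (Bool; true; false; if_then_else_; not; _∧_)
open import Data.Bool.Properties using (¬-not; not-¬; T-≡)
import Data.Bool.Properties as Bool
open import Data.List using (map; allFin; foldr; tabulate)
open import Data.List.Properties using (map-tabulate)
open import Data.List.Membership.Propositional using (_∈_)
open import Data.List.Membership.Propositional.Properties using (∈-map⁺; ∈-allFin)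
open import Data.List.Relation.Unary.Any using (here; there)
open import Data.List.Relation.Unary.All.Properties using (all⁺; all⁻; tabulate⁺; tabulate⁻)
open import Data.Nat.ListAction using (sum)
open import Data.Bool.ListAction using (and)
open import Data.Product using (Σ; _×_; ∃; _,_; proj₁; proj₂)
open import Data.Sum using (_⊎_; inj₁; inj₂)
open import Data.Unit using (⊤; tt)
open import Function using (_∘_; Equivalence)
open import Function.Definitions using (Injective)
open import Relation.Binary using (Rel; Decidable; tri<; tri≈; tri>)
open import Relation.Binary.Construct.Closure.ReflexiveTransitive using (Star; ε; _◅_; _◅◅_)
open import Relation.Binary.PropositionalEquality
open import Relation.Nullary using (¬_; Dec; yes; no; does; contradiction)
open import Relation.Nullary.Decidable using (_×-dec_; _⊎-dec_; map′; dec-true; dec-false)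
open import Relation.Unary as U using (Pred)
open import Level using (0ℓ)
open import Algebra.Properties.CommutativeMonoid.Sum +-0-commutativeMonoid
  using (sum-syntax; sum-remove; sum-cong-≗; sum-replicate-zero; ∑-distrib-+; ∑-comm)

∧-true⁻ : ∀ {x y} → x ∧ y ≡ true → x ≡ true × y ≡ true
∧-true⁻ {true} {true} _ = refl , refl

∧-true⁺ : ∀ {x y} → x ≡ true → y ≡ true → x ∧ y ≡ true
∧-true⁺ refl refl = refl

not-true⁻ : ∀ {x} → not x ≡ true → x ≡ false
not-true⁻ {false} _ = refl

does-true⁻ : ∀ {a} {A : Set a} (a? : Dec A) → does a? ≡ true → A
does-true⁻ (yes a) _ = a

does-false⁻ : ∀ {a} {A : Set a} (a? : Dec A) → does a? ≡ false → ¬ A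
does-false⁻ (no ¬a) _ = ¬a

𝟙 : Bool → ℕ
𝟙 b = if b then 1 else 0

𝟙-split : ∀ x y → 𝟙 x ≡ 𝟙 (x ∧ y) + 𝟙 (x ∧ not y)
𝟙-split false _     = refl
𝟙-split true  false = refl
𝟙-split true  true  = refl

𝟙-mono : ∀ {x y} → (x ≡ true → y ≡ true) → 𝟙 x ≤ 𝟙 y
𝟙-mono {false} _ = z≤n
𝟙-mono {true}  h rewrite h refl = ≤-refl

∑-mono-≤ : ∀ {k} {f g : Fin k → ℕ} → (∀ x → f x ≤ g x) → ∑[ x < k ] f x ≤ ∑[ x < k ] g x
∑-mono-≤ {zero}  _   = z≤n
∑-mono-≤ {suc k} f≤g = +-mono-≤ (f≤g zero) (∑-mono-≤ (f≤g ∘ suc))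

sum-tabulate : ∀ {k} (f : Fin k → ℕ) → sum (tabulate f) ≡ ∑[ x < k ] f x
sum-tabulate {zero}  f = refl
sum-tabulate {suc k} f = cong (f zero +_) (sum-tabulate (f ∘ suc))

sum-allFin : ∀ {k} (f : Fin k → ℕ) → sum (map f (allFin k)) ≡ ∑[ x < k ] f x
sum-allFin f = trans (cong sum (map-tabulate (λ x → x) f)) (sum-tabulate f)

count≡∑ : ∀ {k} (p : Fin k → Bool) → count k p ≡ ∑[ x < k ] 𝟙 (p x)
count≡∑ p = sum-allFin (𝟙 ∘ p)

count-suc : ∀ {k} (p : Fin (suc k) → Bool) → count (suc k) p ≡ 𝟙 (p zero) + count k (p ∘ suc)
count-suc p = trans (count≡∑ p) (cong (𝟙 (p zero) +_) (sym (count≡∑ (p ∘ suc))))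

count-remove : ∀ {k} (p : Fin (suc k) → Bool) {x} → p x ≡ true →
               count (suc k) p ≡ suc (count k (p ∘ punchIn x))
count-remove {k} p {x} px = begin
  count (suc k) p                              ≡⟨ count≡∑ p ⟩
  ∑[ y < suc k ] 𝟙 (p y)                       ≡⟨ sum-remove {i = x} (𝟙 ∘ p) ⟩
  𝟙 (p x) + ∑[ y < k ] 𝟙 (p (punchIn x y))     ≡⟨ cong₂ _+_ (cong 𝟙 px) (sym (count≡∑ (p ∘ punchIn x))) ⟩
  suc (count k (p ∘ punchIn x))                ∎
  where open ≡-Reasoning

count-mono : ∀ {k} {p q : Fin k → Bool} → (∀ x → p x ≡ true → q x ≡ true) → count k p ≤ count k q
count-mono {p = p} {q} p⊆q =
  subst₂ _≤_ (sym (count≡∑ p)) (sym (count≡∑ q)) (∑-mono-≤ (λ x → 𝟙-mono (p⊆q x)))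

count-∧-≤ : ∀ {k} (p q : Fin k → Bool) → count k (λ x → p x ∧ q x) ≤ count k p
count-∧-≤ p q = count-mono (λ x → proj₁ ∘ ∧-true⁻ {p x})

count≡0 : ∀ {k} {p : Fin k → Bool} → (∀ x → p x ≡ false) → count k p ≡ 0
count≡0 {k} {p} none =
  trans (count≡∑ p) (trans (sum-cong-≗ (cong 𝟙 ∘ none)) (sum-replicate-zero k))

count≡0⊎∃ : ∀ {k} (p : Fin k → Bool) → count k p ≡ 0 ⊎ ∃ λ x → p x ≡ true
count≡0⊎∃ p with any? (λ x → p x Bool.≟ true)
... | yes found = inj₂ found
... | no ∄      = inj₁ (count≡0 (λ x → ¬-not (λ px → ∄ (x , px))))

count-pos : ∀ {k} {p : Fin k → Bool} {x} → p x ≡ true → 1 ≤ count k p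
count-pos {suc k} {p} px = subst (1 ≤_) (sym (count-remove p px)) (s≤s z≤n)

count-witness : ∀ {k} {p : Fin k → Bool} → 1 ≤ count k p → ∃ λ x → p x ≡ true
count-witness {p = p} pos with count≡0⊎∃ p
... | inj₁ none  = contradiction (subst (1 ≤_) none pos) λ ()
... | inj₂ found = found

count≤1 : ∀ {k} {p : Fin k → Bool} → (∀ {x y} → p x ≡ true → p y ≡ true → x ≡ y) → count k p ≤ 1
count≤1 {k} {p} unique with count≡0⊎∃ p
... | inj₁ none = subst (_≤ 1) (sym none) z≤n
count≤1 {suc k} {p} unique | inj₂ (x , px) =
  subst (_≤ 1) (sym (trans (count-remove p px) (cong suc (count≡0 elsewhere)))) ≤-refl
  where
  elsewhere : ∀ y → p (punchIn x y) ≡ false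
  elsewhere y = ¬-not (λ py → punchInᵢ≢i x y (unique py px))

count≡1⇒unique : ∀ {k} {p : Fin k → Bool} → count k p ≡ 1 →
                 ∀ {x y} → p x ≡ true → p y ≡ true → x ≡ y
count≡1⇒unique {suc k} {p} once {x} {y} px py with x ≟ y
... | yes x≡y = x≡y
... | no  x≢y = contradiction (subst (1 ≤_) rest≡0 (count-pos {p = p ∘ punchIn x} py′)) λ ()
  where
  py′ : p (punchIn x (punchOut x≢y)) ≡ true
  py′ = trans (cong p (punchIn-punchOut x≢y)) py
  rest≡0 : count k (p ∘ punchIn x) ≡ 0
  rest≡0 = cong ℕ.pred (trans (sym (count-remove p px)) once)

count-≤-of-≤1 : ∀ {k l} {p : Fin k → Bool} {q : Fin l → Bool} → count k p ≤ 1 →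
                (∀ x → p x ≡ true → ∃ λ y → q y ≡ true) → count k p ≤ count l q
count-≤-of-≤1 {p = p} {q} p≤1 witness with count≡0⊎∃ p
... | inj₁ none = subst (_≤ _) (sym none) z≤n
... | inj₂ (x , px) = ≤-trans p≤1 (count-pos {p = q} (proj₂ (witness x px)))

rank : ∀ {k} → (Fin k → Bool) → Fin k → ℕ
rank p zero    = 0
rank p (suc x) = 𝟙 (p zero) + rank (p ∘ suc) x

rank<count : ∀ {k} (p : Fin k → Bool) {x} → p x ≡ true → rank p x < count k p
rank<count p {zero}  px rewrite count-suc p | px = s≤s z≤n
rank<count p {suc x} px rewrite count-suc p =
  subst (_≤ 𝟙 (p zero) + count _ (p ∘ suc)) (+-suc (𝟙 (p zero)) _)
        (+-monoʳ-≤ (𝟙 (p zero)) (rank<count (p ∘ suc) px))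

rank-injective : ∀ {k} (p : Fin k → Bool) {x y} → p x ≡ true → p y ≡ true → rank p x ≡ rank p y → x ≡ y
rank-injective p {zero}  {zero}  _  _  _ = refl
rank-injective p {zero}  {suc y} px _  r rewrite px = contradiction r λ ()
rank-injective p {suc x} {zero}  _  py r rewrite py = contradiction r λ ()
rank-injective p {suc x} {suc y} px py r =
  cong suc (rank-injective (p ∘ suc) px py (+-cancelˡ-≡ (𝟙 (p zero)) _ _ r))

rank-surjective : ∀ {k} (p : Fin k → Bool) {j} → j < count k p → ∃ λ x → p x ≡ true × rank p x ≡ j
rank-surjective {suc k} p {j} j<count with p zero in p₀ | subst (j <_) (count-suc p) j<count
rank-surjective {suc k} p {zero}  _ | true | _ = zero , p₀ , refl
rank-surjective {suc k} p {suc j} _ | true | s≤s j<rest with rank-surjective (p ∘ suc) j<rest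
... | x , px , r = suc x , px , trans (cong (λ b → 𝟙 b + rank (p ∘ suc) x) p₀) (cong suc r)
rank-surjective {suc k} p {j} _ | false | j<rest with rank-surjective (p ∘ suc) j<rest
... | x , px , r = suc x , px , trans (cong (λ b → 𝟙 b + rank (p ∘ suc) x) p₀) r

∈⇒≤foldr-⊔ : ∀ {x xs} → x ∈ xs → x ≤ foldr _⊔_ 0 xs
∈⇒≤foldr-⊔ (here refl)  = m≤m⊔n _ _
∈⇒≤foldr-⊔ (there x∈xs) = ≤-trans (∈⇒≤foldr-⊔ x∈xs) (m≤n⊔m _ _)

≤maxFin : ∀ {k} (f : Fin k → ℕ) x → f x ≤ maxFin k f
≤maxFin f x = ∈⇒≤foldr-⊔ (∈-map⁺ f (∈-allFin x))

and-allFin⁺ : ∀ {k} (f : Fin k → Bool) → (∀ x → f x ≡ true) → and (map f (allFin k)) ≡ true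
and-allFin⁺ f all-true =
  Equivalence.to T-≡ (all⁻ f (tabulate⁺ (λ x → Equivalence.from T-≡ (all-true x))))

and-allFin⁻ : ∀ {k} (f : Fin k → Bool) → and (map f (allFin k)) ≡ true → ∀ x → f x ≡ true
and-allFin⁻ f all-true x =
  Equivalence.to T-≡ (tabulate⁻ (all⁺ f (allFin _) (Equivalence.from T-≡ all-true)) x)

1≤⇒not<ᵇ1 : ∀ {c} → 1 ≤ c → not (c ℕ.<ᵇ 1) ≡ true
1≤⇒not<ᵇ1 (s≤s _) = refl

module _ {m n : ℕ} (M : EdgeSet m n) where

  inA-true : ∀ {a b} → M a b ≡ true → inA M a ≡ true
  inA-true Mab = 1≤⇒not<ᵇ1 (count-pos {p = M _} Mab)

  inB-true : ∀ {a b} → M a b ≡ true → inB M b ≡ true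
  inB-true Mab = 1≤⇒not<ᵇ1 (count-pos {p = λ a → M a _} Mab)

  inA-false : ∀ {a} → (∀ b → ¬ M a b ≡ true) → inA M a ≡ false
  inA-false {a} none rewrite count≡0 {p = M a} (λ b → ¬-not (none b)) = refl

module _ {m n d : ℕ} (M : Fin d → EdgeSet m n) {i : Fin d} {a : Fin m} where

  Aᵢ⁺ : (∀ j → toℕ j < toℕ i → inA (M j) a ≡ false) → Aᵢ M i a ≡ true
  Aᵢ⁺ earlier = and-allFin⁺ _ step
    where
    step : ∀ j → (if toℕ j ℕ.<ᵇ toℕ i then not (inA (M j) a) else true) ≡ true
    step j with toℕ j ℕ.<ᵇ toℕ i in j<ᵇi
    ... | false = refl
    ... | true  = cong not (earlier j (<ᵇ⇒< _ _ (Equivalence.from T-≡ j<ᵇi)))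

  Aᵢ⁻ : Aᵢ M i a ≡ true → ∀ j → toℕ j < toℕ i → inA (M j) a ≡ false
  Aᵢ⁻ a∈Aᵢ j j<i
    with toℕ j ℕ.<ᵇ toℕ i | Equivalence.to T-≡ (<⇒<ᵇ j<i) | and-allFin⁻ _ a∈Aᵢ j
  ... | true | refl | notInA = not-true⁻ notInA

Bᵢ⁺ : ∀ {m n d} (M : Fin d → EdgeSet m n) (i : Fin d) {b} →
      (∀ j → toℕ i ≡ suc (toℕ j) → inB (M j) b ≡ true) → Bᵢ M i b ≡ true
Bᵢ⁺ M zero    _        = refl
Bᵢ⁺ M (suc i) previous = previous (inject₁ i) (cong suc (sym (toℕ-inject₁ i)))

size-split : ∀ {m n} (M : EdgeSet m n) (T : Fin n → Bool) →
             size M ≡ ∑[ b < n ] count m (λ a → M a b ∧ T b) + ∑[ a < m ] count n (λ b → M a b ∧ not (T b))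
size-split {m} {n} M T = begin
  size M
    ≡⟨ sum-allFin (degA M) ⟩
  ∑[ a < m ] count n (M a)
    ≡⟨ sum-cong-≗ (λ a → trans (count≡∑ (M a)) (sum-cong-≗ (λ b → 𝟙-split (M a b) (T b)))) ⟩
  ∑[ a < m ] ∑[ b < n ] (𝟙 (M a b ∧ T b) + 𝟙 (M a b ∧ not (T b)))
    ≡⟨ sum-cong-≗ (λ a → ∑-distrib-+ (λ b → 𝟙 (M a b ∧ T b)) (λ b → 𝟙 (M a b ∧ not (T b)))) ⟩
  ∑[ a < m ] (∑[ b < n ] 𝟙 (M a b ∧ T b) + ∑[ b < n ] 𝟙 (M a b ∧ not (T b)))
    ≡⟨ ∑-distrib-+ (λ a → ∑[ b < n ] 𝟙 (M a b ∧ T b)) (λ a → ∑[ b < n ] 𝟙 (M a b ∧ not (T b))) ⟩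
  ∑[ a < m ] ∑[ b < n ] 𝟙 (M a b ∧ T b) + ∑[ a < m ] ∑[ b < n ] 𝟙 (M a b ∧ not (T b))
    ≡⟨ cong₂ _+_ (∑-comm (λ a b → 𝟙 (M a b ∧ T b)))
                 (sum-cong-≗ (λ a → sym (count≡∑ (λ b → M a b ∧ not (T b))))) ⟩
  ∑[ b < n ] ∑[ a < m ] 𝟙 (M a b ∧ T b) + ∑[ a < m ] count n (λ b → M a b ∧ not (T b))
    ≡⟨ cong₂ _+_ (sum-cong-≗ (λ b → sym (count≡∑ (λ a → M a b ∧ T b)))) refl ⟩
  ∑[ b < n ] count m (λ a → M a b ∧ T b) + ∑[ a < m ] count n (λ b → M a b ∧ not (T b))
    ∎
  where open ≡-Reasoning

module Walks {n : ℕ} (R : Rel (Fin n) 0ℓ) where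

  length : ∀ {b c} → Star R b c → ℕ
  length ε       = 0
  length (_ ◅ w) = suc (length w)

  vertex : ∀ {b c} (w : Star R b c) → Fin (suc (length w)) → Fin n
  vertex {b} w       zero    = b
  vertex     (_ ◅ w) (suc i) = vertex w i

  vertex-last : ∀ {b c} (w : Star R b c) → vertex w (fromℕ (length w)) ≡ c
  vertex-last ε       = refl
  vertex-last (_ ◅ w) = vertex-last w

  edge : ∀ {b c} (w : Star R b c) (i : Fin (length w)) → R (vertex w (inject₁ i)) (vertex w (suc i))
  edge (r ◅ _) zero    = r
  edge (_ ◅ w) (suc i) = edge w i

  _∈ʷ_ : ∀ {b c} → Fin n → Star R b c → Set
  _∈ʷ_ {b} x ε       = x ≡ b
  _∈ʷ_ {b} x (_ ◅ w) = x ≡ b ⊎ x ∈ʷ w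

  _∈ʷ?_ : ∀ {b c} x (w : Star R b c) → Dec (x ∈ʷ w)
  _∈ʷ?_ {b} x ε       = x ≟ b
  _∈ʷ?_ {b} x (_ ◅ w) = x ≟ b ⊎-dec x ∈ʷ? w

  vertex-∈ʷ : ∀ {b c} (w : Star R b c) i → vertex w i ∈ʷ w
  vertex-∈ʷ ε       zero    = refl
  vertex-∈ʷ (_ ◅ w) zero    = inj₁ refl
  vertex-∈ʷ (_ ◅ w) (suc i) = inj₂ (vertex-∈ʷ w i)

  Simple : ∀ {b c} → Star R b c → Set
  Simple ε           = ⊤
  Simple {b} (_ ◅ w) = ¬ b ∈ʷ w × Simple w

  dropUntil : ∀ {b c x} (w : Star R b c) → x ∈ʷ w → Simple w → Σ (Star R x c) Simple
  dropUntil ε       refl        _            = ε , tt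
  dropUntil (r ◅ w) (inj₁ refl) simple       = r ◅ w , simple
  dropUntil (_ ◅ w) (inj₂ x∈w)  (_ , simple) = dropUntil w x∈w simple

  simplify : ∀ {b c} → Star R b c → Σ (Star R b c) Simple
  simplify ε = ε , tt
  simplify {b} (r ◅ w) with simplify w
  ... | w′ , simple with b ∈ʷ? w′
  ...   | yes b∈w′ = dropUntil w′ b∈w′ simple
  ...   | no  b∉w′ = r ◅ w′ , b∉w′ , simple

  vertex-injective : ∀ {b c} (w : Star R b c) → Simple w → Injective _≡_ _≡_ (vertex w)
  vertex-injective ε       _            {zero}  {zero}  _ = refl
  vertex-injective (_ ◅ w) _            {zero}  {zero}  _ = refl
  vertex-injective (_ ◅ w) (b∉w , _)    {zero}  {suc j} e = contradiction (subst (_∈ʷ w) (sym e) (vertex-∈ʷ w j)) b∉w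
  vertex-injective (_ ◅ w) (b∉w , _)    {suc i} {zero}  e = contradiction (subst (_∈ʷ w) e (vertex-∈ʷ w i)) b∉w
  vertex-injective (_ ◅ w) (_ , simple) {suc i} {suc j} e = cong suc (vertex-injective w simple e)

  simple-length : ∀ {b c} (w : Star R b c) → Simple w → length w < n
  simple-length w simple = injective⇒≤ (vertex-injective w simple)

  Reachable : Pred (Fin n) 0ℓ → Pred (Fin n) 0ℓ
  Reachable P c = ∃ λ b → P b × Star R b c

  reachable-step : ∀ {P b c} → Reachable P b → R b c → Reachable P c
  reachable-step (a , Pa , w) r = a , Pa , w ◅◅ (r ◅ ε)

  module _ (R? : Decidable R) where

    walkWithin? : ∀ k b c → Dec (Σ (Star R b c) λ w → length w ≤ k)
    walkWithin? zero b c with b ≟ c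
    ... | yes refl = yes (ε , z≤n)
    ... | no  b≢c  = no λ { (ε , _) → b≢c refl }
    walkWithin? (suc k) b c with b ≟ c | any? (λ b′ → R? b b′ ×-dec walkWithin? k b′ c)
    ... | yes refl | _                       = yes (ε , z≤n)
    ... | no _     | yes (_ , r , w , w≤k)   = yes (r ◅ w , s≤s w≤k)
    ... | no b≢c   | no ∄                    =
      no λ { (ε , _) → b≢c refl ; (r ◅ w , s≤s w≤k) → ∄ (_ , r , w , w≤k) }

    -- Simple walks have fewer than n steps, so searching walks of length at most n is exhaustive.
    reachable? : ∀ {P} → U.Decidable P → U.Decidable (Reachable P)
    reachable? {P} P? c = map′ forget shorten (any? λ b → P? b ×-dec walkWithin? n b c)
      where
      ShortWalk : Fin n → Set
      ShortWalk b = P b × Σ (Star R b c) λ w → length w ≤ n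
      forget : ∃ ShortWalk → Reachable P c
      forget (b , Pb , w , _) = b , Pb , w
      shorten : Reachable P c → ∃ ShortWalk
      shorten (b , Pb , w) with simplify w
      ... | w′ , simple = b , Pb , w′ , <⇒≤ (simple-length w′ simple)

module _ {m n : ℕ} (E S : EdgeSet m n) where

  Alternating : Rel (Fin n) 0ℓ
  Alternating b b′ = ∃ λ a → S a b ≡ true × E a b′ ≡ true × S a b′ ≡ false

  alternating? : Decidable Alternating
  alternating? b b′ = any? λ a → S a b Bool.≟ true ×-dec E a b′ Bool.≟ true ×-dec S a b′ Bool.≟ false

module SemiMatching {m n : ℕ} {E S : EdgeSet m n} (semi : IsSemiMatching E S) where

  open Walks (Alternating E S)

  partner-exists : ∀ a → ∃ λ b → S a b ≡ true
  partner-exists a = count-witness {p = S a} (≤-reflexive (sym (proj₂ semi a)))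

  partner : Fin m → Fin n
  partner = proj₁ ∘ partner-exists

  partner-∈S : ∀ a → S a (partner a) ≡ true
  partner-∈S = proj₂ ∘ partner-exists

  partner-unique : ∀ {a b} → S a b ≡ true → b ≡ partner a
  partner-unique {a} Sab = count≡1⇒unique (proj₂ semi a) Sab (partner-∈S a)

  simple⇒degMinPath : ∀ {b c} (w : Star (Alternating E S) b c) → Simple w →
                      degB S c + 2 ≤ degB S b → DegMinPath E S
  simple⇒degMinPath {b} ε _ gap = contradiction gap (m+1+n≰m (degB S b))
  simple⇒degMinPath {b} w@(_ ◅ _) simple gap = record
    { l      = length w
    ; l≥1    = s≤s z≤n
    ; bs     = vertex w
    ; as     = as
    ; bs-inj = vertex-injective w simple
    ; as-inj = λ {i} {j} e → inject₁-injective (vertex-injective w simple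
                 (trans (partner-unique (inS i)) (trans (cong partner e) (sym (partner-unique (inS j))))))
    ; inS    = inS
    ; inE    = proj₁ ∘ proj₂ ∘ proj₂ ∘ edge w
    ; notS   = proj₂ ∘ proj₂ ∘ proj₂ ∘ edge w
    ; degGap = subst (λ c → degB S c + 2 ≤ degB S b) (sym (vertex-last w)) gap
    }
    where
    as : Fin (length w) → Fin m
    as = proj₁ ∘ edge w
    inS : ∀ i → S (as i) (vertex w (inject₁ i)) ≡ true
    inS = proj₁ ∘ proj₂ ∘ edge w

  alternating-degB : ¬ DegMinPath E S → ∀ {b c} → Star (Alternating E S) b c → degB S b ≤ suc (degB S c)
  alternating-degB noPath {b} {c} w with degB S b ℕ.≤? suc (degB S c) | simplify w
  ... | yes le | _            = le
  ... | no  gt | w′ , simple  =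
    contradiction (simple⇒degMinPath w′ simple (subst (_≤ degB S b) (+-comm 2 (degB S c)) (≰⇒> gt))) noPath

  level : Fin m → Fin n → ℕ
  level a b = rank (λ a′ → S a′ b) a

  level<degB : ∀ {a b} → S a b ≡ true → level a b < degB S b
  level<degB {b = b} = rank<count (λ a′ → S a′ b)

  levelIndex : ∀ {a b} → S a b ≡ true → Fin (degMax S)
  levelIndex {b = b} Sab = fromℕ< (<-≤-trans (level<degB Sab) (≤-trans (≤maxFin (degB S) b) (m≤n⊔m _ _)))

  layer : Fin (degMax S) → EdgeSet m n
  layer i a b = S a b ∧ does (level a b ℕ.≟ toℕ i)

  layer⁺ : ∀ {i a b} → S a b ≡ true → level a b ≡ toℕ i → layer i a b ≡ true
  layer⁺ {i} {a} {b} Sab l = ∧-true⁺ Sab (dec-true (level a b ℕ.≟ toℕ i) l)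

  layer⁻ : ∀ {i a b} → layer i a b ≡ true → S a b ≡ true × level a b ≡ toℕ i
  layer⁻ {i} {a} {b} h with ∧-true⁻ {S a b} h
  ... | Sab , l = Sab , does-true⁻ (level a b ℕ.≟ toℕ i) l

  layer-levelIndex : ∀ {a b} (Sab : S a b ≡ true) → layer (levelIndex Sab) a b ≡ true
  layer-levelIndex Sab = layer⁺ Sab (sym (toℕ-fromℕ< _))

  layer-covers : ∀ {i b} → toℕ i < degB S b → ∃ λ a → layer i a b ≡ true
  layer-covers {i} i<deg with rank-surjective _ i<deg
  ... | a , Sab , l = a , layer⁺ Sab l

  layers-partition : IsPartition S layer
  layers-partition =
      (λ i a b → proj₁ ∘ layer⁻)
    , (λ a b Sab → levelIndex Sab , layer-levelIndex Sab)
    , (λ a b i j hi hj → toℕ-injective (trans (sym (proj₂ (layer⁻ hi))) (proj₂ (layer⁻ hj))))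

  layer-matching : ∀ i → IsMatching (layer i)
  layer-matching i =
      (λ a → subst (degA (layer i) a ≤_) (proj₂ semi a) (count-∧-≤ (S a) _))
    , (λ b → count≤1 λ hx hy →
         rank-injective (λ a′ → S a′ b) (proj₁ (layer⁻ {i} hx)) (proj₁ (layer⁻ {i} hy))
                        (trans (proj₂ (layer⁻ {i} hx)) (sym (proj₂ (layer⁻ {i} hy)))))

  layer-partner-level : ∀ {i a b} → layer i a b ≡ true → level a (partner a) ≡ toℕ i
  layer-partner-level {i} {a} h with layer⁻ {i} h
  ... | Sab , l = trans (cong (level a) (sym (partner-unique Sab))) l

  layer-in-Aᵢ : ∀ i {a b} → layer i a b ≡ true → Aᵢ layer i a ≡ true
  layer-in-Aᵢ i {a} h = Aᵢ⁺ layer earlier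
    where
    earlier : ∀ j → toℕ j < toℕ i → inA (layer j) a ≡ false
    earlier j j<i = inA-false (layer j) λ _ h′ →
      <-irrefl (trans (sym (layer-partner-level {j} h′)) (layer-partner-level {i} h)) j<i

  layer-in-Bᵢ : ∀ i {a b} → layer i a b ≡ true → Bᵢ layer i b ≡ true
  layer-in-Bᵢ i {a} {b} h = Bᵢ⁺ layer i previous
    where
    previous : ∀ j → toℕ i ≡ suc (toℕ j) → inB (layer j) b ≡ true
    previous j i≡1+j = inB-true (layer j) (proj₂ (layer-covers
      (<⇒≤ (subst (_< degB S b) (trans (proj₂ (layer⁻ h)) i≡1+j) (level<degB (proj₁ (layer⁻ h)))))))

  layer⊆induced : ∀ i → layer i ⊆ induced E (Aᵢ layer i) (Bᵢ layer i)
  layer⊆induced i a b h =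
    ∧-true⁺ (proj₁ semi a b (proj₁ (layer⁻ h))) (∧-true⁺ (layer-in-Aᵢ i h) (layer-in-Bᵢ i h))

module Maximality {m n : ℕ} {E S : EdgeSet m n} (semi : IsSemiMatching E S) (noPath : ¬ DegMinPath E S)
                  (i : Fin (degMax S)) where

  open SemiMatching semi
  open Walks (Alternating E S)

  Heavy : Pred (Fin n) 0ℓ
  Heavy b = 2 + toℕ i ≤ degB S b

  Tree : Pred (Fin n) 0ℓ
  Tree = Reachable Heavy

  tree? : U.Decidable Tree
  tree? = reachable? (alternating? E S) (λ b → 2 + toℕ i ℕ.≤? degB S b)

  inTree : Fin n → Bool
  inTree b = does (tree? b)

  tree-covered : ∀ {b} → Tree b → ∃ λ a → layer i a b ≡ true
  tree-covered (_ , heavy , w) = layer-covers (s≤s⁻¹ (≤-trans heavy (alternating-degB noPath w)))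

  partner-outside-tree : ∀ {a b} → Aᵢ layer i a ≡ true → E a b ≡ true → ¬ Tree b →
                         layer i a (partner a) ≡ true × ¬ Tree (partner a)
  partner-outside-tree {a} {b} a∈Aᵢ Eab b∉T = layer⁺ (partner-∈S a) level≡i , partner∉T
    where
    partner∉T : ¬ Tree (partner a)
    partner∉T p∈T with S a b in Sab
    ... | true  = b∉T (subst Tree (sym (partner-unique Sab)) p∈T)
    ... | false = b∉T (reachable-step p∈T (a , partner-∈S a , Eab , Sab))
    j : Fin (degMax S)
    j = levelIndex (partner-∈S a)
    level≡i : level a (partner a) ≡ toℕ i
    level≡i with <-cmp (level a (partner a)) (toℕ i)
    ... | tri≈ _ eq _ = eq
    ... | tri< l<i _ _ =
      contradiction (inA-true (layer j) (layer-levelIndex (partner-∈S a)))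
                    (not-¬ (Aᵢ⁻ layer a∈Aᵢ j (subst (_< toℕ i) (sym (toℕ-fromℕ< _)) l<i)))
    ... | tri> _ _ i<l = contradiction (partner a , ≤-trans (s≤s i<l) (level<degB (partner-∈S a)) , ε) partner∉T

  layer-maximum : IsMaximumMatching (induced E (Aᵢ layer i) (Bᵢ layer i)) (layer i)
  layer-maximum = layer⊆induced i , layer-matching i , maximum
    where
    maximum : ∀ M′ → M′ ⊆ induced E (Aᵢ layer i) (Bᵢ layer i) → IsMatching M′ → size M′ ≤ size (layer i)
    maximum M′ M′⊆H (M′-A , M′-B) =
      subst₂ _≤_ (sym (size-split M′ inTree)) (sym (size-split (layer i) inTree))
        (+-mono-≤ (∑-mono-≤ inside) (∑-mono-≤ outside))
      where
      inside : ∀ b → count m (λ a → M′ a b ∧ inTree b) ≤ count m (λ a → layer i a b ∧ inTree b)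
      inside b = count-≤-of-≤1 (≤-trans (count-∧-≤ (λ a → M′ a b) (λ _ → inTree b)) (M′-B b)) covered
        where
        covered : ∀ a → M′ a b ∧ inTree b ≡ true → ∃ λ a′ → layer i a′ b ∧ inTree b ≡ true
        covered a h with ∧-true⁻ {M′ a b} h
        ... | _ , b∈T with tree-covered (does-true⁻ (tree? b) b∈T)
        ...   | a′ , l = a′ , ∧-true⁺ l b∈T

      outside : ∀ a → count n (λ b → M′ a b ∧ not (inTree b)) ≤ count n (λ b → layer i a b ∧ not (inTree b))
      outside a = count-≤-of-≤1 (≤-trans (count-∧-≤ (M′ a) (not ∘ inTree)) (M′-A a)) matched
        where
        matched : ∀ b → M′ a b ∧ not (inTree b) ≡ true → ∃ λ b′ → layer i a b′ ∧ not (inTree b′) ≡ true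
        matched b h with ∧-true⁻ {M′ a b} h
        ... | M′ab , b∉T with ∧-true⁻ {E a b} (M′⊆H a b M′ab)
        ...   | Eab , a∈H
          with partner-outside-tree (proj₁ (∧-true⁻ a∈H)) Eab (does-false⁻ (tree? b) (not-true⁻ b∉T))
        ...     | l , p∉T = partner a , ∧-true⁺ l (cong not (dec-false (tree? (partner a)) p∉T))

lemma14 : (m n : ℕ) (E S : EdgeSet m n) →
    IsSemiMatching E S →
    ¬ DegMinPath E S →
    Σ (Fin (degMax S) → EdgeSet m n) λ M →
      IsPartition S M ×
      (∀ i → IsMatching (M i)) ×
      (∀ i → IsMaximumMatching (induced E (Aᵢ M i) (Bᵢ M i)) (M i))
lemma14 m n E S semi noPath =
  layer , layers-partition , layer-matching , Maximality.layer-maximum semi noPath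
  where open SemiMatching semi
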